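{- Let $k\ge0$ and let $x\in E'_k$ with $x=x^{(k)}_j$ for some $j\ge2$. Then $x-f_{2k+2}=x^{(k)}_{j-1}\in E_k$.
   Context: Define $f_0=1$, $f_1=2$, $f_{2j+2}=f_{2j}+f_{2j+1}$, $f_{2j+3}=f_{2j}+f_{2j+2}$ (the $f_{2j+1}$ are even). Every integer $n\ge0$ has a unique representation $n=\sum_{i\ge0}a_i(n)f_i$ with $a_i(n)\in\{0,1\}$, finitely many nonzero, $a_ia_{i+1}=0$ for all $i$, and $a_ia_{i+2}=0$ for all even $i$. For $k\ge0$ put $\Phi_k(n)=\sum_{i=0}^{2k+2}a_i(n)f_i$. Let $\mathbb{N}=\{0,1,\dots\}$. For $k\ge0$, $E'_k=\{x\in\mathbb{N}:\Phi_k(x)=f_{2k+3}/2\}$, $E''_k=\{x\in\mathbb{N}:\Phi_k(x)=f_{2k+3}/2+f_{2k}\}$, and $E_k=E'_k\cup E''_k=\{x^{(k)}_1<x^{(k)}_2<x^{(k)}_3<\cdots\}$ (increasing enumeration). -}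

module Defs where

open import Data.Nat using (ℕ; zero; suc; _+_; _*_; _∸_; _<_; _%_; ⌊_/2⌋)
open import Data.Bool using (Bool; true; false)
open import Data.List using (List; []; _∷_; length; take)
open import Data.List.Relation.Unary.All using (All)
open import Data.List.Relation.Unary.Unique.Propositional using (Unique)
open import Data.List.Membership.Propositional using (_∈_)
open import Data.Product using (Σ; _×_; ∃)
open import Data.Sum using (_⊎_)
open import Relation.Binary.PropositionalEquality using (_≡_)
open import Relation.Nullary using (¬_)

-- fe j = f_{2j},  fo j = f_{2j+1}
fe : ℕ → ℕ
fo : ℕ → ℕ
fe zero    = 1
fe (suc j) = fe j + fo j
fo zero    = 2
fo (suc j) = fe j + fe (suc j)

f : ℕ → ℕ
f n with n % 2
... | zero  = fe ⌊ n /2⌋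
... | suc _ = fo ⌊ n /2⌋

-- digit sequences (a_0, a_1, ...) as finite lists of bits; a_i = 0 beyond the list
digit : List Bool → ℕ → Bool
digit []       _       = false
digit (b ∷ bs) zero    = b
digit (b ∷ bs) (suc i) = digit bs i

valueFrom : ℕ → List Bool → ℕ
valueFrom s []           = 0
valueFrom s (true ∷ bs)  = f s + valueFrom (suc s) bs
valueFrom s (false ∷ bs) = valueFrom (suc s) bs

value : List Bool → ℕ
value = valueFrom 0

Admissible : List Bool → Set
Admissible a =
  ((i : ℕ) → ¬ (digit a i ≡ true × digit a (suc i) ≡ true)) ×
  ((j : ℕ) → ¬ (digit a (2 * j) ≡ true × digit a (2 * j + 2) ≡ true))

IsRep : ℕ → List Bool → Set
IsRep n a = Admissible a × value a ≡ n

PhiIs : ℕ → ℕ → ℕ → Set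
PhiIs k n m = Σ (List Bool) λ a → IsRep n a × value (take (2 * k + 3) a) ≡ m

E′ : ℕ → ℕ → Set
E′ k x = PhiIs k x ⌊ f (2 * k + 3) /2⌋

E″ : ℕ → ℕ → Set
E″ k x = PhiIs k x (⌊ f (2 * k + 3) /2⌋ + f (2 * k))

E : ℕ → ℕ → Set
E k x = E′ k x ⊎ E″ k x

-- IsNth k j x : x = x^{(k)}_j (1-indexed increasing enumeration of E_k),
-- i.e. x ∈ E_k and exactly j-1 elements of E_k are smaller than x.
IsNth : ℕ → ℕ → ℕ → Set
IsNth k j x =
  E k x ×
  Σ (List ℕ) λ l →
    suc (length l) ≡ j ×
    Unique l ×
    All (λ y → E k y × y < x) l ×
    ((y : ℕ) → E k y → y < x → y ∈ l)

-- If x ∈ E′_k then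
-- Φ_k(x) = f_{2k+3}/2 forces a_{2k+1} = 1 and a_{2k+2} = 0, and since x is not the
-- least element of E_k it has a digit 1 at some position ≥ 2k+3; let i be the lowest.
-- Subtracting f_{2k+2} borrows from that digit: clearing it and filling the odd
-- positions above 2k+2 gives an admissible representation of y = x − f_{2k+2} with
-- the same low part, except for i = 2k+3, where the low part becomes
-- f_{2k+3}/2 + f_{2k}; either way y ∈ E_k. Admissible representations are ordered
-- lexicographically, so any z ∈ E_k strictly between y and x shares their digits
-- above i, and the bound on what the digits between 2k+2 and i can contribute then
-- leaves no room for z.
module Submission where

open import Defs
open import Data.Nat using (ℕ; _+_; _*_; _∸_; _≤_)
open import Data.Product using (Σ; _×_)
open import Relation.Binary.PropositionalEquality using (_≡_)

open import Data.Bool using (Bool; true; false; if_then_else_)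
open import Data.Empty using (⊥; ⊥-elim)
open import Function using (_∘_)
open import Data.Nat using (zero; suc; _<_; _%_; ⌊_/2⌋; z≤n; s≤s; _≤′_; ≤′-refl; ≤′-step)
open import Data.Nat.Properties
open import Data.Nat.Tactic.RingSolver using (solve-∀)
open import Algebra.Properties.CommutativeSemigroup +-commutativeSemigroup using (xy∙z≈xz∙y)
open import Data.Product using (_,_; proj₁; proj₂)
open import Data.List using ([]; _∷_; length; take; filter; applyUpTo)
open import Data.List.Properties using (length-take; length-applyUpTo; filter-accept; filter-reject; filter-all)
open import Data.List.Membership.Propositional using (_∈_)
open import Data.List.Membership.Propositional.Properties using (∈-filter⁺)
open import Data.List.Relation.Unary.All using (All; _∷_)
import Data.List.Relation.Unary.All as All
import Data.List.Relation.Unary.All.Properties as All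
open import Data.List.Relation.Unary.Any using (here; there)
open import Data.List.Relation.Unary.AllPairs using (_∷_)
open import Data.List.Relation.Unary.Unique.Propositional using (Unique)
import Data.List.Relation.Unary.Unique.Propositional.Properties as Unique
open import Data.Sum using (_⊎_; inj₁; inj₂)
open import Relation.Nullary using (¬_; yes; no)
open import Relation.Binary.PropositionalEquality
  using (refl; sym; trans; cong; cong₂; subst; subst₂; _≢_; module ≡-Reasoning)

double : ℕ → ℕ
double zero    = zero
double (suc q) = suc (suc (double q))

2*≡double : ∀ q → 2 * q ≡ double q
2*≡double zero    = refl
2*≡double (suc q) = trans (cong suc (+-suc q (q + 0))) (cong (λ n → suc (suc n)) (2*≡double q))

2*q+2≡double-suc : ∀ q → 2 * q + 2 ≡ double (suc q)
2*q+2≡double-suc q = trans (+-comm (2 * q) 2) (cong (λ n → suc (suc n)) (2*≡double q))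

2*k+3≡suc-double-suc : ∀ k → 2 * k + 3 ≡ suc (double (suc k))
2*k+3≡suc-double-suc k = trans (+-comm (2 * k) 3) (cong (λ n → suc (suc (suc n))) (2*≡double k))

double-injective : ∀ {p q} → double p ≡ double q → p ≡ q
double-injective {zero}  {zero}  _  = refl
double-injective {suc p} {suc q} eq = cong suc (double-injective (suc-injective (suc-injective eq)))

double≢suc-double : ∀ p q → double p ≢ suc (double q)
double≢suc-double (suc p) (suc q) eq = double≢suc-double p q (suc-injective (suc-injective eq))

double-mono : ∀ {p q} → p ≤ q → double p ≤ double q
double-mono z≤n       = z≤n
double-mono (s≤s p≤q) = s≤s (s≤s (double-mono p≤q))

double-cancel-≤ : ∀ {p q} → double p ≤ suc (double q) → p ≤ q
double-cancel-≤ {zero}          _                 = z≤n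
double-cancel-≤ {suc p} {suc q} (s≤s (s≤s p≤q)) = s≤s (double-cancel-≤ p≤q)

data Parity : ℕ → Set where
  even : ∀ q → Parity (double q)
  odd  : ∀ q → Parity (suc (double q))

parity : ∀ n → Parity n
parity zero = even 0
parity (suc n) with parity n
... | even q = odd q
... | odd q  = even (suc q)

⌊double/2⌋ : ∀ q → ⌊ double q /2⌋ ≡ q
⌊double/2⌋ zero    = refl
⌊double/2⌋ (suc q) = cong suc (⌊double/2⌋ q)

⌊suc-double/2⌋ : ∀ q → ⌊ suc (double q) /2⌋ ≡ q
⌊suc-double/2⌋ zero    = refl
⌊suc-double/2⌋ (suc q) = cong suc (⌊suc-double/2⌋ q)

double%2≡0 : ∀ q → double q % 2 ≡ 0
double%2≡0 zero    = refl
double%2≡0 (suc q) = double%2≡0 q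

suc-double%2≡1 : ∀ q → suc (double q) % 2 ≡ 1
suc-double%2≡1 zero    = refl
suc-double%2≡1 (suc q) = suc-double%2≡1 q

f-double : ∀ q → f (double q) ≡ fe q
f-double q with double q % 2 in eq
... | zero  = cong fe (⌊double/2⌋ q)
... | suc _ with () <- trans (sym eq) (double%2≡0 q)

f-suc-double : ∀ q → f (suc (double q)) ≡ fo q
f-suc-double q with suc (double q) % 2 in eq
... | zero  with () <- trans (sym eq) (suc-double%2≡1 q)
... | suc _ = cong fo (⌊suc-double/2⌋ q)

fe≤fo : ∀ q → fe q ≤ fo q
fe≤fo zero    = s≤s z≤n
fe≤fo (suc q) = m≤n+m (fe (suc q)) (fe q)

fo≤fe-suc : ∀ q → fo q ≤ fe (suc q)
fo≤fe-suc q = m≤n+m (fo q) (fe q)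

fe-positive : ∀ q → 0 < fe q
fe-positive zero    = s≤s z≤n
fe-positive (suc q) = <-≤-trans (fe-positive q) (m≤m+n (fe q) (fo q))

-- Digit sequences and their prefix sums

Digits : Set
Digits = ℕ → Bool

term : Digits → ℕ → ℕ
term d t = if d t then f t else 0

segment : Digits → ℕ → ℕ → ℕ
segment d i zero    = 0
segment d i (suc n) = segment d i n + term d (i + n)

prefix : Digits → ℕ → ℕ
prefix d = segment d 0

prefix-suc : ∀ d n → d n ≡ false × prefix d (suc n) ≡ prefix d n
                   ⊎ d n ≡ true × prefix d (suc n) ≡ prefix d n + f n
prefix-suc d n with d n
... | false = inj₁ (refl , +-identityʳ _)
... | true  = inj₂ (refl , refl)

prefix-false : ∀ {d} n → d n ≡ false → prefix d (suc n) ≡ prefix d n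
prefix-false _ e rewrite e = +-identityʳ _

prefix-true : ∀ {d} n → d n ≡ true → prefix d (suc n) ≡ prefix d n + f n
prefix-true _ e rewrite e = refl

prefix-split : ∀ d i n → prefix d (i + n) ≡ prefix d i + segment d i n
prefix-split d i zero    = trans (cong (prefix d) (+-identityʳ i)) (sym (+-identityʳ _))
prefix-split d i (suc n) = begin
  prefix d (i + suc n)                             ≡⟨ cong (prefix d) (+-suc i n) ⟩
  prefix d (i + n) + term d (i + n)                ≡⟨ cong (_+ term d (i + n)) (prefix-split d i n) ⟩
  prefix d i + segment d i n + term d (i + n)      ≡⟨ +-assoc (prefix d i) _ _ ⟩
  prefix d i + segment d i (suc n)                 ∎
  where open ≡-Reasoning

prefix-mono : ∀ d {m n} → m ≤ n → prefix d m ≤ prefix d n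
prefix-mono d {m} {n} m≤n = begin
  prefix d m                        ≤⟨ m≤m+n _ _ ⟩
  prefix d m + segment d m (n ∸ m)  ≡⟨ prefix-split d m (n ∸ m) ⟨
  prefix d (m + (n ∸ m))            ≡⟨ cong (prefix d) (m+[n∸m]≡n m≤n) ⟩
  prefix d n                        ∎
  where open ≤-Reasoning

prefix-cong : ∀ {d e} n → (∀ t → t < n → d t ≡ e t) → prefix d n ≡ prefix e n
prefix-cong zero    _   = refl
prefix-cong (suc n) d≡e = cong₂ _+_ (prefix-cong n (λ t t<n → d≡e t (m<n⇒m<1+n t<n)))
                                    (cong (λ b → if b then f n else 0) (d≡e n ≤-refl))

prefix-zeros : ∀ d {m} n → (∀ t → m ≤ t → t < n → d t ≡ false) → m ≤ n → prefix d n ≡ prefix d m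
prefix-zeros d zero    _     z≤n = refl
prefix-zeros d (suc n) zeros m≤1+n with m≤n⇒m<n∨m≡n m≤1+n
... | inj₂ refl       = refl
... | inj₁ (s≤s m≤n) = trans (prefix-false n (zeros n m≤n ≤-refl))
                              (prefix-zeros d n (λ t m≤t t<n → zeros t m≤t (m<n⇒m<1+n t<n)) m≤n)

nand-right : ∀ {a b : Bool} → ¬ (a ≡ true × b ≡ true) → a ≡ true → b ≡ false
nand-right {b = false} _     _ = refl
nand-right {b = true}  ¬both a = ⊥-elim (¬both (a , refl))

nand-left : ∀ {a b : Bool} → ¬ (a ≡ true × b ≡ true) → b ≡ true → a ≡ false
nand-left {a = false} _     _ = refl
nand-left {a = true}  ¬both b = ⊥-elim (¬both (refl , b))

record AdmissibleDigits (d : Digits) : Set where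
  constructor mkAdmissible
  field
    no-adjacent : ∀ i → ¬ (d i ≡ true × d (suc i) ≡ true)
    no-even-gap : ∀ q → ¬ (d (double q) ≡ true × d (suc (suc (double q))) ≡ true)

  next-false : ∀ i → d i ≡ true → d (suc i) ≡ false
  next-false i = nand-right (no-adjacent i)

  prev-false : ∀ i → d (suc i) ≡ true → d i ≡ false
  prev-false i = nand-left (no-adjacent i)

  even-next-false : ∀ q → d (double q) ≡ true → d (suc (suc (double q))) ≡ false
  even-next-false q = nand-right (no-even-gap q)

  even-prev-false : ∀ q → d (suc (suc (double q))) ≡ true → d (double q) ≡ false
  even-prev-false q = nand-left (no-even-gap q)

open AdmissibleDigits

prefix-2+double : ∀ {d} → AdmissibleDigits d → ∀ q →
  prefix d (double (suc q)) ≡ prefix d (suc (double q))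
  ⊎ prefix d (double (suc q)) ≡ prefix d (double q) + fo q
prefix-2+double {d} A q with prefix-suc d (suc (double q))
... | inj₁ (_ , p)   = inj₁ p
... | inj₂ (d1 , p) = inj₂ (trans p (cong₂ _+_ (prefix-false (double q) (prev-false A (double q) d1)) (f-suc-double q)))

prefix-3+double : ∀ {d} → AdmissibleDigits d → ∀ q →
  prefix d (suc (double (suc q))) ≡ prefix d (double (suc q))
  ⊎ prefix d (suc (double (suc q))) ≡ prefix d (double q) + fe (suc q)
prefix-3+double {d} A q with prefix-suc d (double (suc q))
... | inj₁ (_ , p)   = inj₁ p
... | inj₂ (d2 , p) = inj₂ (trans p (cong₂ _+_ below (f-double (suc q))))
  where
  below : prefix d (double (suc q)) ≡ prefix d (double q)
  below = trans (prefix-false (suc (double q)) (prev-false A (suc (double q)) d2))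
                (prefix-false (double q) (even-prev-false A q d2))

either-≡ : ∀ (P : ℕ → Set) {x a b} → x ≡ a ⊎ x ≡ b → P a → P b → P x
either-≡ P (inj₁ refl) pa _  = pa
either-≡ P (inj₂ refl) _  pb = pb

prefix<fe : ∀ {d} → AdmissibleDigits d → ∀ q → prefix d (double q) < fe q
prefix<fo : ∀ {d} → AdmissibleDigits d → ∀ q → prefix d (suc (double q)) < fo q

prefix<fe A zero    = s≤s z≤n
prefix<fe A (suc q) = either-≡ (_< fe (suc q)) (prefix-2+double A q)
  (<-≤-trans (prefix<fo A q) (fo≤fe-suc q))
  (+-monoˡ-< (fo q) (prefix<fe A q))

prefix<fo {d} A zero with d 0
... | false = s≤s z≤n
... | true  = s≤s (s≤s z≤n)
prefix<fo A (suc q) = either-≡ (_< fo (suc q)) (prefix-3+double A q)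
  (<-≤-trans (prefix<fe A (suc q)) (m≤n+m _ (fe q)))
  (+-monoˡ-< (fe (suc q)) (prefix<fe A q))

prefix<f : ∀ {d} → AdmissibleDigits d → ∀ i → prefix d i < f i
prefix<f {d} A i with parity i
... | even q = subst (prefix d (double q) <_) (sym (f-double q)) (prefix<fe A q)
... | odd q  = subst (prefix d (suc (double q)) <_) (sym (f-suc-double q)) (prefix<fo A q)

-- The digits strictly between positions 2p and i contribute at most f_i − f_{2p}.
module _ {d} (A : AdmissibleDigits d) (p : ℕ) where
  private
    R = prefix d (suc (double p))

    bound-even : ∀ t → prefix d (double (t + p)) + fe p ≤ fe (t + p) + R
    bound-odd  : ∀ t → prefix d (suc (double (t + p))) + fe p ≤ fo (t + p) + R

    bound-even zero = begin
      prefix d (double p) + fe p ≡⟨ +-comm _ (fe p) ⟩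
      fe p + prefix d (double p) ≤⟨ +-monoʳ-≤ (fe p) (prefix-mono d (n≤1+n _)) ⟩
      fe p + R                   ∎
      where open ≤-Reasoning
    bound-even (suc t) = either-≡ (λ n → n + fe p ≤ fe (suc t + p) + R) (prefix-2+double A (t + p))
      (begin
        prefix d (suc (double (t + p))) + fe p    ≤⟨ bound-odd t ⟩
        fo (t + p) + R                            ≤⟨ +-monoˡ-≤ R (fo≤fe-suc (t + p)) ⟩
        fe (suc t + p) + R                        ∎)
      (begin
        prefix d (double (t + p)) + fo (t + p) + fe p  ≡⟨ xy∙z≈xz∙y (prefix d (double (t + p))) (fo (t + p)) (fe p) ⟩
        prefix d (double (t + p)) + fe p + fo (t + p)  ≤⟨ +-monoˡ-≤ (fo (t + p)) (bound-even t) ⟩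
        fe (t + p) + R + fo (t + p)                    ≡⟨ xy∙z≈xz∙y (fe (t + p)) R _ ⟩
        fe (suc t + p) + R                             ∎)
      where open ≤-Reasoning

    bound-odd zero = begin
      prefix d (suc (double p)) + fe p ≡⟨ +-comm R (fe p) ⟩
      fe p + R                         ≤⟨ +-monoˡ-≤ R (fe≤fo p) ⟩
      fo p + R                         ∎
      where open ≤-Reasoning
    bound-odd (suc t) = either-≡ (λ n → n + fe p ≤ fo (suc t + p) + R) (prefix-3+double A (t + p))
      (begin
        prefix d (double (suc t + p)) + fe p       ≤⟨ bound-even (suc t) ⟩
        fe (suc t + p) + R                         ≤⟨ +-monoˡ-≤ R (m≤n+m _ (fe (t + p))) ⟩
        fo (suc t + p) + R                         ∎)
      (begin
        prefix d (double (t + p)) + fe (suc t + p) + fe p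
          ≡⟨ xy∙z≈xz∙y (prefix d (double (t + p))) (fe (suc t + p)) (fe p) ⟩
        prefix d (double (t + p)) + fe p + fe (suc t + p)   ≤⟨ +-monoˡ-≤ (fe (suc t + p)) (bound-even t) ⟩
        fe (t + p) + R + fe (suc t + p)                     ≡⟨ xy∙z≈xz∙y (fe (t + p)) R _ ⟩
        fo (suc t + p) + R                                  ∎)
      where open ≤-Reasoning

  prefix-tail-bound : ∀ i → double p ≤ i → prefix d i + fe p ≤ f i + prefix d (suc (double p))
  prefix-tail-bound i 2p≤i with parity i
  ... | even q = subst (λ n → prefix d (double q) + fe p ≤ n + R) (sym (f-double q))
                   (subst (λ q → prefix d (double q) + fe p ≤ fe q + R) (m∸n+n≡m p≤q) (bound-even (q ∸ p)))
    where p≤q = double-cancel-≤ (≤-trans 2p≤i (n≤1+n _))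
  ... | odd q  = subst (λ n → prefix d (suc (double q)) + fe p ≤ n + R) (sym (f-suc-double q))
                   (subst (λ q → prefix d (suc (double q)) + fe p ≤ fo q + R) (m∸n+n≡m p≤q) (bound-odd (q ∸ p)))
    where p≤q = double-cancel-≤ 2p≤i

-- The numeration is lexicographic: at the top digit where two segments differ,
-- the lower digits of the smaller one cannot make up that f (prefix<f).
segment<⇒prefix< : ∀ {d e} → AdmissibleDigits d → AdmissibleDigits e → ∀ i n →
  segment e i n < segment d i n → prefix e (i + n) < segment d i n
segment<⇒prefix< {d} {e} Ad Ae i (suc n) lt rewrite +-suc i n
  with d (i + n) | e (i + n)
... | true  | true  = +-monoˡ-< (f (i + n)) (segment<⇒prefix< Ad Ae i n (+-cancelʳ-< _ _ _ lt))
... | false | false = +-monoˡ-< 0 (segment<⇒prefix< Ad Ae i n (+-cancelʳ-< _ _ _ lt))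
... | true  | false = ≤-<-trans (≤-reflexive (+-identityʳ _))
                        (<-≤-trans (prefix<f Ae (i + n)) (m≤n+m _ _))
... | false | true  = ⊥-elim (<⇒≱ lt (begin
  segment d i n + 0          ≡⟨ +-identityʳ _ ⟩
  segment d i n              ≤⟨ m≤n+m _ _ ⟩
  prefix d i + segment d i n ≡⟨ prefix-split d i n ⟨
  prefix d (i + n)           ≤⟨ <⇒≤ (prefix<f Ad (i + n)) ⟩
  f (i + n)                  ≤⟨ m≤n+m _ _ ⟩
  segment e i n + f (i + n)  ∎))
  where open ≤-Reasoning

segment-mono : ∀ {d e} → AdmissibleDigits d → AdmissibleDigits e → ∀ i n →
  prefix d (i + n) ≤ prefix e (i + n) → segment d i n ≤ segment e i n
segment-mono {d} {e} Ad Ae i n le = ≮⇒≥ λ lt → <⇒≱ (segment<⇒prefix< Ad Ae i n lt) (begin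
  segment d i n              ≤⟨ m≤n+m _ _ ⟩
  prefix d i + segment d i n ≡⟨ prefix-split d i n ⟨
  prefix d (i + n)           ≤⟨ le ⟩
  prefix e (i + n)           ∎)
  where open ≤-Reasoning

first-one : ∀ d lo n → prefix d lo < prefix d (lo + n) →
  Σ ℕ λ i → lo ≤ i × d i ≡ true × (∀ t → lo ≤ t → t < i → d t ≡ false)
first-one d lo zero lt = ⊥-elim (<-irrefl (cong (prefix d) (sym (+-identityʳ lo))) lt)
first-one d lo (suc n) lt with prefix-suc d lo
... | inj₂ (dlo , _) = lo , ≤-refl , dlo , λ t lo≤t t<lo → ⊥-elim (<⇒≱ t<lo lo≤t)
... | inj₁ (dlo , p) with first-one d (suc lo) n (subst₂ _<_ (sym p) (cong (prefix d) (+-suc lo n)) lt)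
...   | i , lo<i , di , zeros = i , <⇒≤ lo<i , di , zeros′
  where
  zeros′ : ∀ t → lo ≤ t → t < i → d t ≡ false
  zeros′ t lo≤t t<i with m≤n⇒m<n∨m≡n lo≤t
  ... | inj₁ lo<t = zeros t lo<t t<i
  ... | inj₂ refl = dlo

_[_]≔_ : Digits → ℕ → Bool → Digits
(d [ i ]≔ b) t with t ≟ i
... | yes _ = b
... | no  _ = d t

[]≔-same : ∀ d i b → (d [ i ]≔ b) i ≡ b
[]≔-same d i b with i ≟ i
... | yes _   = refl
... | no  i≢i = ⊥-elim (i≢i refl)

[]≔-other : ∀ d i b {t} → t ≢ i → (d [ i ]≔ b) t ≡ d t
[]≔-other d i b {t} t≢i with t ≟ i
... | yes t≡i = ⊥-elim (t≢i t≡i)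
... | no  _   = refl

[]≔-true : ∀ d i t → (d [ i ]≔ true) t ≡ true → t ≡ i ⊎ d t ≡ true
[]≔-true d i t e with t ≟ i
... | yes t≡i = inj₁ t≡i
... | no  _   = inj₂ e

[]≔-false : ∀ d i t → (d [ i ]≔ false) t ≡ true → d t ≡ true
[]≔-false d i t e with t ≟ i
... | no _ = e

prefix-[]≔-below : ∀ d i b M → M ≤ i → prefix (d [ i ]≔ b) M ≡ prefix d M
prefix-[]≔-below d i b M M≤i = prefix-cong M λ t t<M → []≔-other d i b (<⇒≢ (<-≤-trans t<M M≤i))

prefix-[]≔-above : ∀ d i b M → i < M →
  prefix (d [ i ]≔ b) M + term d i ≡ prefix d M + (if b then f i else 0)
prefix-[]≔-above d i b (suc M) (s≤s i≤M) with m≤n⇒m<n∨m≡n i≤M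
... | inj₂ refl = begin
  prefix d′ i + term d′ i + term d i ≡⟨ cong₂ (λ x y → x + y + term d i) (prefix-[]≔-below d i b i ≤-refl)
                                               (cong (λ c → if c then f i else 0) ([]≔-same d i b)) ⟩
  prefix d i + bv + term d i         ≡⟨ xy∙z≈xz∙y (prefix d i) bv (term d i) ⟩
  prefix d i + term d i + bv         ∎
  where
  open ≡-Reasoning
  d′ = d [ i ]≔ b
  bv = if b then f i else 0
... | inj₁ i<M = begin
  prefix d′ M + term d′ M + term d i ≡⟨ cong (λ c → prefix d′ M + (if c then f M else 0) + term d i)
                                              ([]≔-other d i b (<⇒≢ i<M ∘ sym)) ⟩
  prefix d′ M + term d M + term d i  ≡⟨ xy∙z≈xz∙y (prefix d′ M) (term d M) (term d i) ⟩
  prefix d′ M + term d i + term d M  ≡⟨ cong (_+ term d M) (prefix-[]≔-above d i b M i<M) ⟩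
  prefix d M + bv + term d M         ≡⟨ xy∙z≈xz∙y (prefix d M) bv (term d M) ⟩
  prefix d M + term d M + bv         ∎
  where
  open ≡-Reasoning
  d′ = d [ i ]≔ b
  bv = if b then f i else 0

prefix-set : ∀ {d i} M → d i ≡ false → i < M → prefix (d [ i ]≔ true) M ≡ prefix d M + f i
prefix-set {d} {i} M di i<M = begin
  prefix (d [ i ]≔ true) M                  ≡⟨ +-identityʳ _ ⟨
  prefix (d [ i ]≔ true) M + 0              ≡⟨ cong (λ c → prefix (d [ i ]≔ true) M + (if c then f i else 0)) di ⟨
  prefix (d [ i ]≔ true) M + term d i       ≡⟨ prefix-[]≔-above d i true M i<M ⟩
  prefix d M + f i                          ∎
  where open ≡-Reasoning

prefix-clear : ∀ {d i} M → d i ≡ true → i < M → prefix (d [ i ]≔ false) M + f i ≡ prefix d M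
prefix-clear {d} {i} M di i<M = begin
  prefix (d [ i ]≔ false) M + f i           ≡⟨ cong (λ c → prefix (d [ i ]≔ false) M + (if c then f i else 0)) di ⟨
  prefix (d [ i ]≔ false) M + term d i      ≡⟨ prefix-[]≔-above d i false M i<M ⟩
  prefix d M + 0                            ≡⟨ +-identityʳ _ ⟩
  prefix d M                                ∎
  where open ≡-Reasoning

true⇒≢false : ∀ {b} → b ≡ true → b ≢ false
true⇒≢false refl ()

AdmissibleDigits-mono : ∀ {d e} → (∀ t → e t ≡ true → d t ≡ true) →
  AdmissibleDigits d → AdmissibleDigits e
AdmissibleDigits-mono e⊆d A = mkAdmissible
  (λ i (x , y) → no-adjacent A i (e⊆d _ x , e⊆d _ y))
  (λ q (x , y) → no-even-gap A q (e⊆d _ x , e⊆d _ y))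

clear-admissible : ∀ {d} i → AdmissibleDigits d → AdmissibleDigits (d [ i ]≔ false)
clear-admissible {d} i = AdmissibleDigits-mono ([]≔-false d i)

set-admissible : ∀ {d} i → AdmissibleDigits d →
  (∀ t → suc t ≡ i → d t ≡ false) → d (suc i) ≡ false →
  (∀ q → double q ≡ i → d (suc (suc (double q))) ≡ false) →
  (∀ q → suc (suc (double q)) ≡ i → d (double q) ≡ false) →
  AdmissibleDigits (d [ i ]≔ true)
set-admissible {d} i A before after even-after even-before = mkAdmissible adjacent gap
  where
  adjacent : ∀ j → ¬ ((d [ i ]≔ true) j ≡ true × (d [ i ]≔ true) (suc j) ≡ true)
  adjacent j (x , y) with []≔-true d i j x | []≔-true d i (suc j) y
  ... | inj₁ j≡i | inj₁ 1+j≡i = <⇒≢ (n<1+n _) (trans j≡i (sym 1+j≡i))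
  ... | inj₁ refl | inj₂ y′   = true⇒≢false y′ after
  ... | inj₂ x′  | inj₁ 1+j≡i = true⇒≢false x′ (before j 1+j≡i)
  ... | inj₂ x′  | inj₂ y′    = no-adjacent A j (x′ , y′)
  gap : ∀ q → ¬ ((d [ i ]≔ true) (double q) ≡ true × (d [ i ]≔ true) (suc (suc (double q))) ≡ true)
  gap q (x , y) with []≔-true d i _ x | []≔-true d i _ y
  ... | inj₁ 2q≡i | inj₁ 2+2q≡i = <⇒≢ (m<n⇒m<1+n (n<1+n _)) (trans 2q≡i (sym 2+2q≡i))
  ... | inj₁ 2q≡i | inj₂ y′     = true⇒≢false y′ (even-after q 2q≡i)
  ... | inj₂ x′   | inj₁ 2+2q≡i = true⇒≢false x′ (even-before q 2+2q≡i)
  ... | inj₂ x′   | inj₂ y′     = no-even-gap A q (x′ , y′)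

set-odd-admissible : ∀ {d} q → AdmissibleDigits d →
  d (double q) ≡ false → d (suc (suc (double q))) ≡ false →
  AdmissibleDigits (d [ suc (double q) ]≔ true)
set-odd-admissible {d} q A before after = set-admissible _ A
  (λ t e → subst (λ t → d t ≡ false) (sym (suc-injective e)) before) after
  (λ p e → ⊥-elim (double≢suc-double p q e))
  (λ p e → ⊥-elim (double≢suc-double (suc p) q e))

set-even-admissible : ∀ {d} q → AdmissibleDigits d →
  d (double q) ≡ false → d (suc (double q)) ≡ false →
  d (suc (suc (suc (double q)))) ≡ false → d (double (suc (suc q))) ≡ false →
  AdmissibleDigits (d [ double (suc q) ]≔ true)
set-even-admissible {d} q A gap-before before after gap-after = set-admissible _ A
  (λ t e → subst (λ t → d t ≡ false) (sym (suc-injective e)) before) after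
  (λ p e → subst (λ p → d (double (suc p)) ≡ false) (sym (double-injective e)) gap-after)
  (λ p e → subst (λ p → d (double p) ≡ false) (sym (suc-injective (double-injective {suc p} e))) gap-before)

-- Borrowing f_{2p}

record Shifted (d : Digits) (p lo c : ℕ) : Set where
  field
    digits     : Digits
    admissible : AdmissibleDigits digits
    shift      : ∀ M → lo ≤ M → prefix digits M + fe p ≡ prefix d M + c
    same-low   : prefix digits (suc (double p)) ≡ prefix d (suc (double p))

-- Filling the odd positions 2p+1, 2p+3, …, 2q−1 adds f_{2q} − f_{2p}, by telescoping
-- f_{2j+2} = f_{2j} + f_{2j+1}.
fill-odd : ∀ {p q d} → p ≤′ q → AdmissibleDigits d →
  (∀ t → double p ≤ t → t ≤ double q → d t ≡ false) →
  Shifted d p (suc (double q)) (fe q)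
fill-odd {d = d} ≤′-refl A _ =
  record { digits = d ; admissible = A ; shift = λ _ _ → refl ; same-low = refl }
fill-odd {p} {suc q} {d} (≤′-step p≤′q) A zeros = record
  { digits     = digits
  ; admissible = admissible
  ; shift      = shift′
  ; same-low   = trans same-low (prefix-[]≔-below d b true _ (s≤s 2p≤2q))
  }
  where
  b = suc (double q)
  2p≤2q = double-mono (≤′⇒≤ p≤′q)
  d₁ = d [ b ]≔ true
  d₁-zeros : ∀ t → double p ≤ t → t ≤ double q → d₁ t ≡ false
  d₁-zeros t 2p≤t t≤2q = trans ([]≔-other d b true (<⇒≢ (s≤s t≤2q)))
    (zeros t 2p≤t (≤-trans t≤2q (≤-trans (n≤1+n _) (n≤1+n _))))
  open Shifted (fill-odd p≤′q
    (set-odd-admissible q A (zeros _ 2p≤2q (≤-trans (n≤1+n _) (n≤1+n _)))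
                            (zeros _ (≤-trans 2p≤2q (≤-trans (n≤1+n _) (n≤1+n _))) ≤-refl))
    d₁-zeros)
  shift′ : ∀ M → suc (double (suc q)) ≤ M → prefix digits M + fe p ≡ prefix d M + fe (suc q)
  shift′ M le = begin
    prefix digits M + fe p      ≡⟨ shift M (≤-trans (n≤1+n _) (≤-trans (n≤1+n _) le)) ⟩
    prefix d₁ M + fe q          ≡⟨ cong (_+ fe q) (prefix-set M (zeros b (≤-trans 2p≤2q (n≤1+n _)) (n≤1+n _))
                                                                (≤-trans (n≤1+n _) le)) ⟩
    prefix d M + f b + fe q     ≡⟨ cong (λ n → prefix d M + n + fe q) (f-suc-double q) ⟩
    prefix d M + fo q + fe q    ≡⟨ +-assoc (prefix d M) (fo q) (fe q) ⟩
    prefix d M + (fo q + fe q)  ≡⟨ cong (prefix d M +_) (+-comm (fo q) (fe q)) ⟩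
    prefix d M + fe (suc q)     ∎
    where open ≡-Reasoning

borrow-even : ∀ p q {d} → AdmissibleDigits d → d (double q) ≡ true → p < q →
  (∀ t → double p ≤ t → t < double q → d t ≡ false) → Shifted d p (suc (double q)) 0
borrow-even p q {d} A di p<q zeros = record
  { digits     = digits
  ; admissible = admissible
  ; shift      = shift′
  ; same-low   = trans same-low (prefix-[]≔-below d i false _ (≤-trans (n≤1+n _) (double-mono p<q)))
  }
  where
  i = double q
  d₀ = d [ i ]≔ false
  d₀-zeros : ∀ t → double p ≤ t → t ≤ i → d₀ t ≡ false
  d₀-zeros t 2p≤t t≤i with m≤n⇒m<n∨m≡n t≤i
  ... | inj₁ t<i  = trans ([]≔-other d i false (<⇒≢ t<i)) (zeros t 2p≤t t<i)
  ... | inj₂ refl = []≔-same d i false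
  open Shifted (fill-odd (≤⇒≤′ (<⇒≤ p<q)) (clear-admissible i A) d₀-zeros)
  shift′ : ∀ M → suc i ≤ M → prefix digits M + fe p ≡ prefix d M + 0
  shift′ M i<M = begin
    prefix digits M + fe p  ≡⟨ shift M i<M ⟩
    prefix d₀ M + fe q      ≡⟨ cong (prefix d₀ M +_) (f-double q) ⟨
    prefix d₀ M + f i       ≡⟨ prefix-clear M di i<M ⟩
    prefix d M              ≡⟨ +-identityʳ _ ⟨
    prefix d M + 0          ∎
    where open ≡-Reasoning

-- f_{2q+3} − f_{2p} = f_{2q+2} + (f_{2q} − f_{2p}): set digit 2q+2 and fill below it.
borrow-odd : ∀ p q {d} → AdmissibleDigits d → d (suc (double (suc q))) ≡ true → p ≤ q →
  (∀ t → double p ≤ t → t < suc (double (suc q)) → d t ≡ false) →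
  Shifted d p (suc (suc (double (suc q)))) 0
borrow-odd p q {d} A di p≤q zeros = record
  { digits     = digits
  ; admissible = admissible
  ; shift      = shift′
  ; same-low   = trans same-low (trans (prefix-[]≔-below d₀ j true _ 2p+1≤j)
                                       (prefix-[]≔-below d i false _ (≤-trans 2p+1≤j (n≤1+n _))))
  }
  where
  j = double (suc q)
  i = suc j
  2p+1≤j : suc (double p) ≤ j
  2p+1≤j = ≤-trans (n≤1+n _) (double-mono (s≤s p≤q))
  d₀ = d [ i ]≔ false
  d₁ = d₀ [ j ]≔ true
  zero-below : ∀ t → double p ≤ t → t ≤ j → d₀ t ≡ false
  zero-below t 2p≤t t≤j = trans ([]≔-other d i false (<⇒≢ (s≤s t≤j))) (zeros t 2p≤t (s≤s t≤j))
  A₁ : AdmissibleDigits d₁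
  A₁ = set-even-admissible q (clear-admissible i A)
    (zero-below _ (double-mono p≤q) (≤-trans (n≤1+n _) (n≤1+n _)))
    (zero-below _ (≤-trans (double-mono p≤q) (n≤1+n _)) (n≤1+n _))
    ([]≔-same d i false)
    (trans ([]≔-other d i false (<⇒≢ (n<1+n _) ∘ sym)) (next-false A i di))
  d₁-zeros : ∀ t → double p ≤ t → t ≤ double q → d₁ t ≡ false
  d₁-zeros t 2p≤t t≤2q = trans ([]≔-other d₀ j true (<⇒≢ (s≤s (≤-trans t≤2q (n≤1+n _)))))
                                (zero-below t 2p≤t (≤-trans t≤2q (≤-trans (n≤1+n _) (n≤1+n _))))
  open Shifted (fill-odd (≤⇒≤′ p≤q) A₁ d₁-zeros)
  shift′ : ∀ M → suc i ≤ M → prefix digits M + fe p ≡ prefix d M + 0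
  shift′ M i<M = begin
    prefix digits M + fe p             ≡⟨ shift M (≤-trans (m≤n+m _ 3) i<M) ⟩
    prefix d₁ M + fe q                 ≡⟨ cong (_+ fe q) (prefix-set M dj j<M) ⟩
    prefix d₀ M + f j + fe q           ≡⟨ cong (λ n → prefix d₀ M + n + fe q) (f-double (suc q)) ⟩
    prefix d₀ M + fe (suc q) + fe q    ≡⟨ xy∙z≈xz∙y (prefix d₀ M) (fe (suc q)) (fe q) ⟩
    prefix d₀ M + fe q + fe (suc q)    ≡⟨ +-assoc (prefix d₀ M) (fe q) (fe (suc q)) ⟩
    prefix d₀ M + fo (suc q)           ≡⟨ cong (prefix d₀ M +_) (f-suc-double (suc q)) ⟨
    prefix d₀ M + f i                  ≡⟨ prefix-clear M di i<M ⟩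
    prefix d M                         ≡⟨ +-identityʳ _ ⟨
    prefix d M + 0                     ∎
    where
    open ≡-Reasoning
    j<M = ≤-trans (n≤1+n _) i<M
    dj = zero-below j (≤-trans (n≤1+n _) 2p+1≤j) ≤-refl

borrow : ∀ p i {d} → AdmissibleDigits d → d i ≡ true → double (suc p) ≤ i →
  (∀ t → double p ≤ t → t < i → d t ≡ false) → Shifted d p (suc i) 0
borrow p i A di 2p+2≤i zeros with parity i
... | even q       = borrow-even p q A di (double-cancel-≤ (≤-trans 2p+2≤i (n≤1+n _))) zeros
... | odd zero     with s≤s () <- 2p+2≤i
... | odd (suc q)  = borrow-odd p q A di (double-cancel-≤ (≤-pred (≤-pred 2p+2≤i))) zeros

-- The low part Φ_k

half-fo : ℕ → ℕ
half-fo zero    = 1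
half-fo (suc j) = fe j + half-fo j

fo≡half-fo+half-fo : ∀ j → fo j ≡ half-fo j + half-fo j
fo≡half-fo+half-fo zero    = refl
fo≡half-fo+half-fo (suc j) = begin
  fe j + (fe j + fo j)                         ≡⟨ cong (λ n → fe j + (fe j + n)) (fo≡half-fo+half-fo j) ⟩
  fe j + (fe j + (half-fo j + half-fo j))      ≡⟨ lemma (fe j) (half-fo j) ⟩
  fe j + half-fo j + (fe j + half-fo j)        ∎
  where
  open ≡-Reasoning
  lemma : ∀ a b → a + (a + (b + b)) ≡ a + b + (a + b)
  lemma = solve-∀

half-fo≤fe : ∀ j → half-fo j ≤ fe j
half-fo≤fe zero    = ≤-refl
half-fo≤fe (suc j) = +-monoʳ-≤ (fe j) (≤-trans (m≤m+n _ _) (≤-reflexive (sym (fo≡half-fo+half-fo j))))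

half-fo-positive : ∀ j → 0 < half-fo j
half-fo-positive zero    = s≤s z≤n
half-fo-positive (suc j) = <-≤-trans (half-fo-positive j) (m≤n+m _ (fe j))

half-f : ℕ → ℕ
half-f k = half-fo (suc k)

⌊f[2k+3]/2⌋≡half-f : ∀ k → ⌊ f (2 * k + 3) /2⌋ ≡ half-f k
⌊f[2k+3]/2⌋≡half-f k = begin
  ⌊ f (2 * k + 3) /2⌋                    ≡⟨ cong (λ n → ⌊ f n /2⌋) (2*k+3≡suc-double-suc k) ⟩
  ⌊ f (suc (double (suc k))) /2⌋         ≡⟨ cong ⌊_/2⌋ (f-suc-double (suc k)) ⟩
  ⌊ fo (suc k) /2⌋                       ≡⟨ cong ⌊_/2⌋ (fo≡half-fo+half-fo (suc k)) ⟩
  ⌊ half-f k + half-f k /2⌋              ≡⟨ n≡⌊n+n/2⌋ (half-f k) ⟨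
  half-f k                               ∎
  where open ≡-Reasoning

half-f<fe : ∀ k → half-f k < fe (suc k)
half-f<fe k = +-monoʳ-< (fe k) (begin-strict
  half-fo k                ≡⟨ +-identityʳ _ ⟨
  half-fo k + 0            <⟨ +-monoʳ-< (half-fo k) (half-fo-positive k) ⟩
  half-fo k + half-fo k    ≡⟨ fo≡half-fo+half-fo k ⟨
  fo k                     ∎)
  where open ≤-Reasoning

fo≤half-f : ∀ k → fo k ≤ half-f k
fo≤half-f k = ≤-trans (≤-reflexive (fo≡half-fo+half-fo k)) (+-monoˡ-≤ (half-fo k) (half-fo≤fe k))

Φ : ℕ → Digits → ℕ
Φ k d = prefix d (suc (double (suc k)))

data InE (k : ℕ) (d : Digits) : Set where
  in-E′ : Φ k d ≡ half-f k → InE k d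
  in-E″ : Φ k d ≡ half-f k + fe k → InE k d

half-f≤Φ : ∀ {k d} → InE k d → half-f k ≤ Φ k d
half-f≤Φ (in-E′ eq) = ≤-reflexive (sym eq)
half-f≤Φ (in-E″ eq) = ≤-trans (m≤m+n _ _) (≤-reflexive (sym eq))

module _ (k : ℕ) {d} (A : AdmissibleDigits d) where

  E′-digit-2k+2 : Φ k d ≡ half-f k → d (double (suc k)) ≡ false
  E′-digit-2k+2 eq with prefix-suc d (double (suc k))
  ... | inj₁ (d2k+2 , _) = d2k+2
  ... | inj₂ (_ , p) = ⊥-elim (<⇒≱ (half-f<fe k) (begin
    fe (suc k)                                   ≤⟨ m≤n+m (fe (suc k)) (prefix d (double (suc k))) ⟩
    prefix d (double (suc k)) + fe (suc k)       ≡⟨ cong (prefix d (double (suc k)) +_) (f-double (suc k)) ⟨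
    prefix d (double (suc k)) + f (double (suc k)) ≡⟨ trans (sym p) eq ⟩
    half-f k                                  ∎))
    where open ≤-Reasoning

  E′-digit-2k+1 : Φ k d ≡ half-f k → d (suc (double k)) ≡ true
  E′-digit-2k+1 eq with prefix-suc d (suc (double k))
  ... | inj₂ (d2k+1 , _) = d2k+1
  ... | inj₁ (_ , p) = ⊥-elim (<⇒≱ (prefix<fo A k) (begin
    fo k                         ≤⟨ fo≤half-f k ⟩
    half-f k                     ≡⟨ sym eq ⟩
    Φ k d                        ≡⟨ prefix-false (double (suc k)) (E′-digit-2k+2 eq) ⟩
    prefix d (double (suc k))    ≡⟨ p ⟩
    prefix d (suc (double k))    ∎))
    where open ≤-Reasoning

  E″-digit-2k+2 : Φ k d ≡ half-f k + fe k → d (double (suc k)) ≡ true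
  E″-digit-2k+2 eq with prefix-suc d (double (suc k))
  ... | inj₂ (d2k+2 , _) = d2k+2
  ... | inj₁ (_ , p) = ⊥-elim (<⇒≱ (prefix<fe A (suc k)) (begin
    fe k + fo k                 ≤⟨ +-monoʳ-≤ (fe k) (fo≤half-f k) ⟩
    fe k + half-f k             ≡⟨ +-comm (fe k) _ ⟩
    half-f k + fe k             ≡⟨ trans (sym eq) p ⟩
    prefix d (double (suc k))   ∎))
    where open ≤-Reasoning

record Predecessor (k : ℕ) (d : Digits) (i : ℕ) : Set where
  field
    digits     : Digits
    admissible : AdmissibleDigits digits
    shift      : ∀ M → suc i ≤ M → prefix digits M + fe (suc k) ≡ prefix d M
    low        : Φ k digits ≡ Φ k d ⊎ Φ k digits ≡ Φ k d + fe k

-- f_{2k+3} − f_{2k+2} = f_{2k} lies below position 2k+3, so here the low part grows.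
borrow-low : ∀ k {d} → AdmissibleDigits d → d (suc (double k)) ≡ true →
  d (double (suc k)) ≡ false → d (suc (double (suc k))) ≡ true →
  Predecessor k d (suc (double (suc k)))
borrow-low k {d} A dc dj≡false dm = record
  { digits = d₂ ; admissible = A₂ ; shift = shift ; low = inj₂ low }
  where
  c = suc (double k)
  j = double (suc k)
  m = suc j
  d₀ = d [ m ]≔ false
  d₁ = d₀ [ c ]≔ false
  d₂ = d₁ [ j ]≔ true
  d₀c : d₀ c ≡ true
  d₀c = trans ([]≔-other d m false {c} (<⇒≢ (n≤1+n _))) dc
  d₁-below-c : ∀ {t} → c < t → d₁ t ≡ d₀ t
  d₁-below-c c<t = []≔-other d₀ c false (<⇒≢ c<t ∘ sym)
  d₁j : d₁ j ≡ false
  d₁j = trans (d₁-below-c ≤-refl) (trans ([]≔-other d m false (<⇒≢ ≤-refl)) dj≡false)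
  A₂ : AdmissibleDigits d₂
  A₂ = set-even-admissible k (clear-admissible c (clear-admissible m A))
    (trans ([]≔-other d₀ c false {double k} (<⇒≢ ≤-refl))
           (trans ([]≔-other d m false (<⇒≢ (≤-trans (n≤1+n _) (n≤1+n _)))) (prev-false A _ dc)))
    ([]≔-same d₀ c false)
    (trans (d₁-below-c {m} (n≤1+n _)) ([]≔-same d m false))
    (trans (d₁-below-c {suc m} (≤-trans (n≤1+n _) (n≤1+n _)))
           (trans ([]≔-other d m false (<⇒≢ ≤-refl ∘ sym)) (next-false A m dm)))
  regroup : ∀ a b c e → a + (b + c) + e ≡ a + c + (b + e)
  regroup = solve-∀
  shift : ∀ M → suc m ≤ M → prefix d₂ M + fe (suc k) ≡ prefix d M
  shift M m<M = begin
    prefix d₂ M + fe (suc k)                      ≡⟨ cong (_+ fe (suc k)) (prefix-set M d₁j j<M) ⟩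
    prefix d₁ M + f j + fe (suc k)                ≡⟨ cong (λ n → prefix d₁ M + n + fe (suc k)) (f-double (suc k)) ⟩
    prefix d₁ M + (fe k + fo k) + fe (suc k)      ≡⟨ regroup (prefix d₁ M) (fe k) (fo k) (fe (suc k)) ⟩
    prefix d₁ M + fo k + fo (suc k)               ≡⟨ cong (λ n → prefix d₁ M + n + fo (suc k)) (f-suc-double k) ⟨
    prefix d₁ M + f c + fo (suc k)                ≡⟨ cong (_+ fo (suc k)) (prefix-clear M d₀c c<M) ⟩
    prefix d₀ M + fo (suc k)                      ≡⟨ cong (prefix d₀ M +_) (f-suc-double (suc k)) ⟨
    prefix d₀ M + f m                             ≡⟨ prefix-clear M dm m<M ⟩
    prefix d M                                    ∎
    where
    open ≡-Reasoning
    j<M = ≤-trans (n≤1+n _) m<M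
    c<M = ≤-trans (m≤n+m _ 2) m<M
  low : prefix d₂ m ≡ prefix d m + fe k
  low = begin
    prefix d₂ m                       ≡⟨ prefix-set m d₁j ≤-refl ⟩
    prefix d₁ m + f j                 ≡⟨ cong (prefix d₁ m +_) (f-double (suc k)) ⟩
    prefix d₁ m + (fe k + fo k)       ≡⟨ cong (λ n → prefix d₁ m + (fe k + n)) (f-suc-double k) ⟨
    prefix d₁ m + (fe k + f c)        ≡⟨ cong (prefix d₁ m +_) (+-comm (fe k) (f c)) ⟩
    prefix d₁ m + (f c + fe k)        ≡⟨ +-assoc (prefix d₁ m) (f c) (fe k) ⟨
    prefix d₁ m + f c + fe k          ≡⟨ cong (_+ fe k) (prefix-clear m d₀c (n≤1+n _)) ⟩
    prefix d₀ m + fe k                ≡⟨ cong (_+ fe k) (prefix-[]≔-below d m false m ≤-refl) ⟩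
    prefix d m + fe k                 ∎
    where open ≡-Reasoning

predecessor : ∀ k {d} i → AdmissibleDigits d → Φ k d ≡ half-f k →
  d i ≡ true → suc (double (suc k)) ≤ i →
  (∀ t → suc (double (suc k)) ≤ t → t < i → d t ≡ false) → Predecessor k d i
predecessor k {d} i A Φ≡ di m≤i zeros with m≤n⇒m<n∨m≡n m≤i
... | inj₂ refl = borrow-low k A (E′-digit-2k+1 k A Φ≡) (E′-digit-2k+2 k A Φ≡) di
... | inj₁ m<i  = record
  { digits     = digits
  ; admissible = admissible
  ; shift      = λ M i<M → trans (shift M i<M) (+-identityʳ _)
  ; low        = inj₁ same-low
  }
  where
  zeros′ : ∀ t → double (suc k) ≤ t → t < i → d t ≡ false
  zeros′ t 2k+2≤t t<i with m≤n⇒m<n∨m≡n 2k+2≤t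
  ... | inj₁ 2k+2<t = zeros t 2k+2<t t<i
  ... | inj₂ refl   = E′-digit-2k+2 k A Φ≡
  open Shifted (borrow (suc k) i A di m<i zeros′)

gap-bound : ∀ k {d} i → AdmissibleDigits d → InE k d → suc (double (suc k)) ≤ i →
  prefix d (suc i) < half-f k + f i → prefix d (suc i) + fe (suc k) ≤ half-f k + f i
gap-bound k {d} i A inE m≤i lt with prefix-suc d i
... | inj₂ (_ , p) = ⊥-elim (<⇒≱ lt (begin
  half-f k + f i     ≤⟨ +-monoˡ-≤ (f i) (≤-trans (half-f≤Φ inE) (prefix-mono d m≤i)) ⟩
  prefix d i + f i   ≡⟨ p ⟨
  prefix d (suc i)   ∎))
  where open ≤-Reasoning
... | inj₁ (_ , p) = subst (λ n → n + fe (suc k) ≤ half-f k + f i) (sym p) (bound inE (m≤n⇒m<n∨m≡n m≤i))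
  where
  open ≤-Reasoning
  bound : InE k d → suc (double (suc k)) < i ⊎ suc (double (suc k)) ≡ i → prefix d i + fe (suc k) ≤ half-f k + f i
  bound (in-E′ eq) _ = begin
    prefix d i + fe (suc k)  ≤⟨ prefix-tail-bound A (suc k) i (≤-trans (n≤1+n _) m≤i) ⟩
    f i + Φ k d              ≡⟨ cong (f i +_) eq ⟩
    f i + half-f k           ≡⟨ +-comm (f i) _ ⟩
    half-f k + f i           ∎
  bound (in-E″ eq) (inj₂ refl) = begin
    Φ k d + fe (suc k)                    ≡⟨ cong (_+ fe (suc k)) eq ⟩
    half-f k + fe k + fe (suc k)          ≡⟨ +-assoc (half-f k) (fe k) _ ⟩
    half-f k + fo (suc k)                 ≡⟨ cong (half-f k +_) (f-suc-double (suc k)) ⟨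
    half-f k + f (suc (double (suc k)))   ∎
  bound (in-E″ eq) (inj₁ m<i) = +-cancelʳ-≤ (fe k) _ _ (begin
    prefix d i + fe (suc k) + fe k            ≤⟨ +-monoʳ-≤ (prefix d i + fe (suc k)) (m≤m+n (fe k) (fe (suc k))) ⟩
    prefix d i + fe (suc k) + fo (suc k)      ≡⟨ +-assoc (prefix d i) (fe (suc k)) (fo (suc k)) ⟩
    prefix d i + fe (suc (suc k))             ≤⟨ prefix-tail-bound A (suc (suc k)) i m<i ⟩
    f i + prefix d (suc (double (suc (suc k)))) ≡⟨ cong (f i +_) 2k+5≡ ⟩
    f i + (half-f k + fe k)                   ≡⟨ +-comm (f i) _ ⟩
    half-f k + fe k + f i                     ≡⟨ xy∙z≈xz∙y (half-f k) (fe k) (f i) ⟩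
    half-f k + f i + fe k                     ∎)
    where
    d2k+2 = E″-digit-2k+2 k A eq
    2k+5≡ : prefix d (suc (double (suc (suc k)))) ≡ half-f k + fe k
    2k+5≡ = trans (prefix-false (double (suc (suc k))) (even-next-false A (suc k) d2k+2))
                  (trans (prefix-false (suc (double (suc k))) (next-false A (double (suc k)) d2k+2)) eq)

Admissible⇒AdmissibleDigits : ∀ {a} → Admissible a → AdmissibleDigits (digit a)
Admissible⇒AdmissibleDigits {a} (adjacent , gap) = mkAdmissible adjacent
  (λ q → subst₂ (λ s t → ¬ (digit a s ≡ true × digit a t ≡ true)) (2*≡double q) (2*q+2≡double-suc q) (gap q))

AdmissibleDigits⇒Admissible : ∀ {a} → AdmissibleDigits (digit a) → Admissible a
AdmissibleDigits⇒Admissible {a} A = no-adjacent A ,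
  (λ j → subst₂ (λ s t → ¬ (digit a s ≡ true × digit a t ≡ true)) (sym (2*≡double j)) (sym (2*q+2≡double-suc j))
                (no-even-gap A j))

digit-beyond : ∀ a {t} → length a ≤ t → digit a t ≡ false
digit-beyond []      _         = refl
digit-beyond (_ ∷ a) (s≤s len≤t) = digit-beyond a len≤t

prefix+valueFrom : ∀ d s bs → (∀ t → d (s + t) ≡ digit bs t) →
  prefix d s + valueFrom s bs ≡ prefix d (s + length bs)
prefix+valueFrom d s []       _      = trans (+-identityʳ _) (cong (prefix d) (sym (+-identityʳ s)))
prefix+valueFrom d s (b ∷ bs) agrees = begin
  prefix d s + valueFrom s (b ∷ bs)            ≡⟨ head-step b (trans (cong d (sym (+-identityʳ s))) (agrees 0)) ⟩
  prefix d (suc s) + valueFrom (suc s) bs      ≡⟨ prefix+valueFrom d (suc s) bs agrees′ ⟩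
  prefix d (suc s + length bs)                 ≡⟨ cong (prefix d) (sym (+-suc s (length bs))) ⟩
  prefix d (s + length (b ∷ bs))               ∎
  where
  open ≡-Reasoning
  agrees′ : ∀ t → d (suc s + t) ≡ digit bs t
  agrees′ t = trans (cong d (sym (+-suc s t))) (agrees (suc t))
  head-step : ∀ c → d s ≡ c → prefix d s + valueFrom s (c ∷ bs) ≡ prefix d (suc s) + valueFrom (suc s) bs
  head-step true  ds = trans (sym (+-assoc (prefix d s) (f s) _)) (cong (_+ valueFrom (suc s) bs) (sym (prefix-true s ds)))
  head-step false ds = cong (_+ valueFrom (suc s) bs) (sym (prefix-false s ds))

value≡prefix : ∀ a N → length a ≤ N → value a ≡ prefix (digit a) N
value≡prefix a N len≤N = trans (prefix+valueFrom (digit a) 0 a (λ _ → refl))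
  (sym (prefix-zeros (digit a) N (λ t len≤t _ → digit-beyond a len≤t) len≤N))

digit-take : ∀ m a {t} → t < m → digit (take m a) t ≡ digit a t
digit-take (suc m) []      _         = refl
digit-take (suc m) (b ∷ a) {zero}  _         = refl
digit-take (suc m) (b ∷ a) {suc t} (s≤s t<m) = digit-take m a t<m

value-take : ∀ m a → value (take m a) ≡ prefix (digit a) m
value-take m a = trans (value≡prefix (take m a) m (≤-trans (≤-reflexive (length-take m a)) (m⊓n≤m m (length a))))
                       (prefix-cong m λ t t<m → digit-take m a t<m)

digit-applyUpTo : ∀ d n {t} → t < n → digit (applyUpTo d n) t ≡ d t
digit-applyUpTo d (suc n) {zero}  _         = refl
digit-applyUpTo d (suc n) {suc t} (s≤s t<n) = digit-applyUpTo (d ∘ suc) n t<n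

digit-applyUpTo-true : ∀ d n t → digit (applyUpTo d n) t ≡ true → d t ≡ true
digit-applyUpTo-true d n t e with t <? n
... | yes t<n = trans (sym (digit-applyUpTo d n t<n)) e
... | no  t≮n = ⊥-elim (true⇒≢false e (digit-beyond (applyUpTo d n)
                                         (≤-trans (≤-reflexive (length-applyUpTo d n)) (≮⇒≥ t≮n))))

record Representation (x : ℕ) : Set where
  field
    digits     : Digits
    admissible : AdmissibleDigits digits
    size       : ℕ
    value≡     : ∀ N → size ≤ N → prefix digits N ≡ x

open Representation

representation-Φ : ∀ k {x c} → PhiIs k x c → Σ (Representation x) λ r → Φ k (digits r) ≡ c
representation-Φ k (a , (adm , val) , low) =
  record { digits = digit a ; admissible = Admissible⇒AdmissibleDigits {a} adm ; size = length a
         ; value≡ = λ N len≤N → trans (sym (value≡prefix a N len≤N)) val }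
  , trans (sym (value-take (suc (double (suc k))) a)) (trans (cong (λ n → value (take n a)) (sym (2*k+3≡suc-double-suc k))) low)

f[2k+2]≡fe : ∀ k → f (2 * k + 2) ≡ fe (suc k)
f[2k+2]≡fe k = trans (cong f (2*q+2≡double-suc k)) (f-double (suc k))

E″-value : ∀ k → ⌊ f (2 * k + 3) /2⌋ + f (2 * k) ≡ half-f k + fe k
E″-value k = cong₂ _+_ (⌊f[2k+3]/2⌋≡half-f k) (trans (cong f (2*≡double k)) (f-double k))

representation-E′ : ∀ k {x} → E′ k x → Σ (Representation x) λ r → Φ k (digits r) ≡ half-f k
representation-E′ k x∈E′ with representation-Φ k x∈E′
... | r , low = r , trans low (⌊f[2k+3]/2⌋≡half-f k)

representation-E : ∀ k {x} → E k x → Σ (Representation x) (InE k ∘ digits)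
representation-E k (inj₁ x∈E′) with representation-E′ k x∈E′
... | r , low = r , in-E′ low
representation-E k (inj₂ x∈E″) with representation-Φ k x∈E″
... | r , low = r , in-E″ (trans low (E″-value k))

PhiIs-digits : ∀ {k d} N → AdmissibleDigits d → suc (double (suc k)) ≤ N → PhiIs k (prefix d N) (Φ k d)
PhiIs-digits {k} {d} N A m≤N = a , (admissible-a , value-a) , Φ-a
  where
  a = applyUpTo d N
  admissible-a = AdmissibleDigits⇒Admissible {a} (AdmissibleDigits-mono (digit-applyUpTo-true d N) A)
  value-a : value a ≡ prefix d N
  value-a = trans (value≡prefix a N (≤-reflexive (length-applyUpTo d N)))
                  (prefix-cong N λ t t<N → digit-applyUpTo d N t<N)
  Φ-a : value (take (2 * k + 3) a) ≡ Φ k d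
  Φ-a = trans (cong (λ n → value (take n a)) (2*k+3≡suc-double-suc k))
        (trans (value-take _ a) (prefix-cong _ λ t t<m → digit-applyUpTo d N (<-≤-trans t<m m≤N)))

InE⇒E : ∀ {k d} N → AdmissibleDigits d → InE k d → suc (double (suc k)) ≤ N → E k (prefix d N)
InE⇒E {k} N A (in-E′ low) m≤N =
  inj₁ (subst (PhiIs k _) (trans low (sym (⌊f[2k+3]/2⌋≡half-f k))) (PhiIs-digits N A m≤N))
InE⇒E {k} N A (in-E″ low) m≤N =
  inj₂ (subst (PhiIs k _) (trans low (sym (E″-value k))) (PhiIs-digits N A m≤N))

-- The predecessor in E_k

segment-≡ : ∀ {d e c} i n → prefix e i + c ≡ prefix d i → prefix e (i + n) + c ≡ prefix d (i + n) →
  segment e i n ≡ segment d i n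
segment-≡ {d} {e} {c} i n low high = +-cancelˡ-≡ (prefix e i + c) _ _ (begin
  prefix e i + c + segment e i n   ≡⟨ xy∙z≈xz∙y (prefix e i) c _ ⟩
  prefix e i + segment e i n + c   ≡⟨ cong (_+ c) (prefix-split e i n) ⟨
  prefix e (i + n) + c             ≡⟨ high ⟩
  prefix d (i + n)                 ≡⟨ prefix-split d i n ⟩
  prefix d i + segment d i n       ≡⟨ cong (_+ segment d i n) low ⟨
  prefix e i + c + segment d i n   ∎)
  where open ≡-Reasoning

-- By segment-mono, z is forced to agree with y and x on the digits [i, i + n).
squeeze : ∀ {dy dz dx} → AdmissibleDigits dy → AdmissibleDigits dz → AdmissibleDigits dx → ∀ i n →
  segment dy i n ≡ segment dx i n →
  prefix dy (i + n) < prefix dz (i + n) → prefix dz (i + n) < prefix dx (i + n) →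
  prefix dy i < prefix dz i × prefix dz i < prefix dx i
squeeze {dy} {dz} {dx} Ay Az Ax i n same y<z z<x = cancel y<z′ , cancel z<x′
  where
  z≡x : segment dz i n ≡ segment dx i n
  z≡x = ≤-antisym (segment-mono Az Ax i n (<⇒≤ z<x))
                  (subst (_≤ segment dz i n) same (segment-mono Ay Az i n (<⇒≤ y<z)))
  cancel : ∀ {a b} → a + segment dx i n < b + segment dx i n → a < b
  cancel = +-cancelʳ-< _ _ _
  y<z′ : prefix dy i + segment dx i n < prefix dz i + segment dx i n
  y<z′ = subst₂ _<_ (trans (prefix-split dy i n) (cong (prefix dy i +_) same))
                    (trans (prefix-split dz i n) (cong (prefix dz i +_) z≡x)) y<z
  z<x′ : prefix dz i + segment dx i n < prefix dx i + segment dx i n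
  z<x′ = subst₂ _<_ (trans (prefix-split dz i n) (cong (prefix dz i +_) z≡x)) (prefix-split dx i n) z<x

no-E-between : ∀ k {x y i dy} (rx : Representation x) → AdmissibleDigits dy →
  prefix (digits rx) (suc i) ≡ half-f k + f i → suc (double (suc k)) ≤ i →
  (∀ M → suc i ≤ M → prefix dy M + fe (suc k) ≡ prefix (digits rx) M) → y + fe (suc k) ≡ x →
  ∀ z → E k z → y < z → z < x → ⊥
no-E-between k {x} {y} {i} {dy} rx Ay x-low m≤i shift y+≡x z z∈E y<z z<x with representation-E k z∈E
... | rz , z∈E′ = <⇒≱ dy<dz (+-cancelʳ-≤ (fe (suc k)) _ _ (begin
  prefix dz (suc i) + fe (suc k)  ≤⟨ gap-bound k i (admissible rz) z∈E′ m≤i (subst (prefix dz (suc i) <_) x-low dz<dx) ⟩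
  half-f k + f i                  ≡⟨ x-low ⟨
  prefix dx (suc i)               ≡⟨ shift (suc i) ≤-refl ⟨
  prefix dy (suc i) + fe (suc k)  ∎))
  where
  open ≤-Reasoning
  dx = digits rx
  dz = digits rz
  n = size rx + size rz
  x≡ : prefix dx (suc i + n) ≡ x
  x≡ = value≡ rx _ (≤-trans (m≤m+n _ _) (m≤n+m n (suc i)))
  z≡ : prefix dz (suc i + n) ≡ z
  z≡ = value≡ rz _ (≤-trans (m≤n+m _ (size rx)) (m≤n+m n (suc i)))
  y≡ : prefix dy (suc i + n) ≡ y
  y≡ = +-cancelʳ-≡ _ _ _ (trans (shift _ (m≤m+n _ n)) (trans x≡ (sym y+≡x)))
  squeezed = squeeze Ay (admissible rz) (admissible rx) (suc i) n
    (segment-≡ (suc i) n (shift (suc i) ≤-refl) (shift _ (m≤m+n _ n)))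
    (subst₂ _<_ (sym y≡) (sym z≡) y<z) (subst₂ _<_ (sym z≡) (sym x≡) z<x)
  dy<dz = proj₁ squeezed
  dz<dx = proj₂ squeezed

length-filter-< : ∀ {y} l → Unique l → y ∈ l → All (_≤ y) l → suc (length (filter (_<? y) l)) ≡ length l
length-filter-< {y} (w ∷ l) (w∉l ∷ uniq) (here refl) (_ ∷ l≤y) =
  cong suc (trans (cong length (filter-reject (_<? y) (<-irrefl refl))) (cong length (filter-all (_<? y) l<y)))
  where
  l<y : All (_< y) l
  l<y = All.zipWith (λ (y≢w , w≤y) → ≤∧≢⇒< w≤y (y≢w ∘ sym)) (w∉l , l≤y)
length-filter-< {y} (w ∷ l) (w∉l ∷ uniq) (there y∈l) (w≤y ∷ l≤y) =
  trans (cong (suc ∘ length) (filter-accept (_<? y) (≤∧≢⇒< w≤y λ w≡y → All.lookup w∉l y∈l w≡y)))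
        (cong suc (length-filter-< l uniq y∈l l≤y))

smaller-element : ∀ k {j x} → IsNth k j x → 2 ≤ j → Σ ℕ λ w → E k w × w < x
smaller-element k (_ , []    , refl , _) (s≤s ())
smaller-element k (_ , w ∷ _ , _ , _ , w∈E,w<x ∷ _ , _) _ = w , w∈E,w<x

IsNth-predecessor : ∀ k {j x y} → IsNth k j x → E k y → y < x →
  (∀ z → E k z → y < z → z < x → ⊥) → IsNth k (j ∸ 1) y
IsNth-predecessor k {y = y} (_ , l , refl , uniq , below-x , complete) y∈E y<x gap =
  y∈E , filter (_<? y) l , length-filter-< l uniq (complete y y∈E y<x) l≤y
      , Unique.filter⁺ (_<? y) uniq
      , All.zipWith (λ ((w∈E , _) , w<y) → w∈E , w<y)
                    (All.filter⁺ (_<? y) below-x , All.all-filter (_<? y) l)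
      , λ w w∈E w<y → ∈-filter⁺ (_<? y) (complete w w∈E (<-trans w<y y<x)) w<y
  where
  l≤y = All.map (λ (w∈E , w<x) → ≮⇒≥ λ y<w → gap _ w∈E y<w w<x) below-x

half-f≤E : ∀ k {w} → E k w → half-f k ≤ w
half-f≤E k w∈E with representation-E k w∈E
... | rw , w∈E′ = begin
  half-f k                                               ≤⟨ half-f≤Φ w∈E′ ⟩
  Φ k (digits rw)                                        ≤⟨ prefix-mono (digits rw) (m≤m+n _ (size rw)) ⟩
  prefix (digits rw) (suc (double (suc k)) + size rw)    ≡⟨ value≡ rw _ (m≤n+m _ _) ⟩
  _                                                      ∎
  where open ≤-Reasoning

E-predecessor : ∀ k {x} (rx : Representation x) → Φ k (digits rx) ≡ half-f k → half-f k < x →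
  Σ ℕ λ y → y + fe (suc k) ≡ x × E k y × (∀ z → E k z → y < z → z < x → ⊥)
E-predecessor k {x} rx Φx half-f<x
  with first-one (digits rx) (suc (double (suc k))) (size rx)
         (subst₂ _<_ (sym Φx) (sym (value≡ rx _ (m≤n+m _ _))) half-f<x)
... | i , m≤i , di , zeros = y , y+≡x , InE⇒E N P.admissible inE m≤N
                           , no-E-between k rx P.admissible x-low m≤i P.shift y+≡x
  where
  module P = Predecessor (predecessor k i (admissible rx) Φx di m≤i zeros)
  N = suc i + size rx
  m≤N = ≤-trans m≤i (≤-trans (n≤1+n i) (m≤m+n _ _))
  y = prefix P.digits N
  y+≡x : y + fe (suc k) ≡ x
  y+≡x = trans (P.shift N (m≤m+n _ _)) (value≡ rx N (m≤n+m _ _))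
  inE : InE k P.digits
  inE with P.low
  ... | inj₁ eq = in-E′ (trans eq Φx)
  ... | inj₂ eq = in-E″ (trans eq (cong (_+ fe k) Φx))
  x-low : prefix (digits rx) (suc i) ≡ half-f k + f i
  x-low = trans (prefix-true i di) (cong (_+ f i) (trans (prefix-zeros (digits rx) i zeros m≤i) Φx))

lemma2 : (k j x : ℕ) → 2 ≤ j → E′ k x → IsNth k j x →
    Σ ℕ (λ y → y + f (2 * k + 2) ≡ x × IsNth k (j ∸ 1) y × E k y)
lemma2 k j x 2≤j x∈E′ x-nth =
  let rx , Φx                = representation-E′ k x∈E′
      w , w∈E , w<x          = smaller-element k x-nth 2≤j
      y , y+≡x , y∈E , gap   = E-predecessor k rx Φx (≤-<-trans (half-f≤E k w∈E) w<x)
      y<x                    = subst (y <_) y+≡x (m<m+n y (fe-positive (suc k)))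
  in y , trans (cong (y +_) (f[2k+2]≡fe k)) y+≡x , IsNth-predecessor k x-nth y∈E y<x gap , y∈E
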